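{- Let $r \geq 2$ be an integer and let $T_r$ be the triangular grid graph of dimension $r$. Then $OD(T_r) \geq r+1$.
   Context: The triangular grid graph $T_r$ of dimension $r$ has as vertex set all ordered triples $(i,j,k)$ of nonnegative integers with $i+j+k=r$; two vertices $(i,j,k)$ and $(i',j',k')$ are adjacent if and only if $|i-i'|+|j-j'|+|k-k'| = 2$. An orientation of an undirected graph assigns a direction to each edge; it is strongly connected if every vertex can reach every other vertex by a directed path. The diameter of a (directed) graph is the maximum, over all ordered pairs of vertices, of the shortest (directed) path distance, measured in number of edges. The oriented diameter $OD(G)$ of an undirected graph $G$ is the minimum diameter over all strongly connected orientations of $G$. -}

module Defs where

open import Data.Nat using (ℕ; zero; suc; _+_; _≤_; ∣_-_∣)
open import Data.Bool using (Bool; true; false)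
open import Data.Product using (Σ; _×_; _,_; ∃-syntax)
open import Data.Sum using (_⊎_)
open import Relation.Nullary using (¬_)
open import Relation.Binary.PropositionalEquality using (_≡_)

record Vertex (r : ℕ) : Set where
  constructor vtx
  field
    i j k : ℕ
    sum≡ : i + j + k ≡ r
open Vertex public

Adj : {r : ℕ} → Vertex r → Vertex r → Set
Adj u v = ∣ i u - i v ∣ + ∣ j u - j v ∣ + ∣ k u - k v ∣ ≡ 2

record Orientation (r : ℕ) : Set where
  field
    arc       : Vertex r → Vertex r → Bool
    arc⇒adj   : ∀ u v → arc u v ≡ true → Adj u v
    adj⇒arc   : ∀ u v → Adj u v → arc u v ≡ true ⊎ arc v u ≡ true
    antisym   : ∀ u v → arc u v ≡ true → ¬ (arc v u ≡ true)
open Orientation public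

data Walk {r : ℕ} (o : Orientation r) : Vertex r → Vertex r → ℕ → Set where
  [] : ∀ {u} → Walk o u u zero
  _∷_ : ∀ {u w v n} → arc o u w ≡ true → Walk o w v n → Walk o u v (suc n)

DistLe : {r : ℕ} → Orientation r → Vertex r → Vertex r → ℕ → Set
DistLe o u v d = ∃[ n ] (n ≤ d × Walk o u v n)

StronglyConnected : {r : ℕ} → Orientation r → Set
StronglyConnected o = ∀ u v → ∃[ n ] Walk o u v n

DiamLe : {r : ℕ} → Orientation r → ℕ → Set
DiamLe o d = ∀ u v → DistLe o u v d

ODLe : ℕ → ℕ → Set
ODLe r d = Σ (Orientation r) λ o → StronglyConnected o × DiamLe o d

-- The k-coordinate changes by at most one along an edge.  A walk of length
-- at most r between the corners (r,0,0) and (0,0,r) must therefore raise or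
-- lower k at every step, so the walk from (r,0,0) starts with the arc to its
-- unique neighbour with k = 1, namely (r-1,0,1), and the walk back ends with
-- the arc from that same vertex: the edge would be oriented both ways.
module Submission where

open import Defs
open import Data.Nat using (ℕ; zero; suc; _+_; _≤_; _<_; z≤n; s≤s; ∣_-_∣; _≤?_)
open import Data.Nat.Properties
open import Data.Product using (_,_; _×_; ∃-syntax)
open import Data.Bool using (true)
open import Relation.Nullary using (¬_; yes; no; contradiction)
open import Relation.Binary.PropositionalEquality

m+n≡2⇒2≤n⇒m≡0 : ∀ {m n} → m + n ≡ 2 → 2 ≤ n → m ≡ 0
m+n≡2⇒2≤n⇒m≡0 {m} {n} m+n≡2 2≤n =
  n≤0⇒n≡0 (+-cancelʳ-≤ 2 m 0 (≤-trans (+-monoʳ-≤ m 2≤n) (≤-reflexive m+n≡2)))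

squeeze : ∀ c m x → c + suc m ≤ m + x → x ≤ suc c → x ≡ suc c
squeeze c m x lower upper = ≤-antisym upper (+-cancelˡ-≤ m (suc c) x m+1+c≤m+x)
  where
  m+1+c≤m+x : m + suc c ≤ m + x
  m+1+c≤m+x = ≤-trans (≤-reflexive (trans (+-suc m c) (+-comm (suc m) c))) lower

module _ {r : ℕ} where

  k-determined : {u v : Vertex r} → i u ≡ i v → j u ≡ j v → k u ≡ k v
  k-determined {vtx a b c p} {vtx .a .b c′ q} refl refl = +-cancelˡ-≡ (a + b) c c′ (trans p (sym q))

  Vertex-≡ : {u v : Vertex r} → j u ≡ j v → k u ≡ k v → u ≡ v
  Vertex-≡ {vtx a b c p} {vtx a′ .b .c q} refl refl
    with +-cancelʳ-≡ b a a′ (+-cancelʳ-≡ c (a + b) (a′ + b) (trans p (sym q)))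
  ... | refl = cong (vtx a b c) (≡-irrelevant p q)

  Adj-sym : (u v : Vertex r) → Adj u v → Adj v u
  Adj-sym u v adj
    rewrite ∣-∣-comm (i u) (i v) | ∣-∣-comm (j u) (j v) | ∣-∣-comm (k u) (k v) = adj

  -- If k jumped by two, the other two coordinates would agree, and then so would k.
  Adj⇒∣Δk∣≤1 : (u v : Vertex r) → Adj u v → ∣ k u - k v ∣ ≤ 1
  Adj⇒∣Δk∣≤1 u v adj with ∣ k u - k v ∣ ≤? 1
  ... | yes Δk≤1 = Δk≤1
  ... | no Δk≰1 = contradiction (m≡n⇒∣m-n∣≡0 (k-determined {u} {v} iu≡iv ju≡jv)) (m<n⇒n≢0 (≰⇒> Δk≰1))
    where
    Δi+Δj≡0 : ∣ i u - i v ∣ + ∣ j u - j v ∣ ≡ 0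
    Δi+Δj≡0 = m+n≡2⇒2≤n⇒m≡0 adj (≰⇒> Δk≰1)
    iu≡iv : i u ≡ i v
    iu≡iv = ∣m-n∣≡0⇒m≡n (m+n≡0⇒m≡0 _ Δi+Δj≡0)
    ju≡jv : j u ≡ j v
    ju≡jv = ∣m-n∣≡0⇒m≡n (m+n≡0⇒n≡0 _ Δi+Δj≡0)

  Adj⇒k≤1+k : (u v : Vertex r) → Adj u v → k v ≤ suc (k u)
  Adj⇒k≤1+k u v adj = ≤-trans (m≤∣m-n∣+n (k v) (k u)) (+-monoˡ-≤ (k u) (Adj⇒∣Δk∣≤1 v u (Adj-sym u v adj)))

  cornerᵢ : Vertex r
  cornerᵢ = vtx r 0 0 (trans (+-identityʳ (r + 0)) (+-identityʳ r))

  cornerₖ : Vertex r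
  cornerₖ = vtx 0 0 r refl

  cornerᵢ-neighbour-j≡0 : (w : Vertex r) → Adj cornerᵢ w → k w ≡ 1 → j w ≡ 0
  cornerᵢ-neighbour-j≡0 (vtx a zero .1 p) adj refl = refl
  cornerᵢ-neighbour-j≡0 (vtx a (suc b) .1 p) adj refl = contradiction (sym adj) (<⇒≢ 2<Δ)
    where
    a<r : a < r
    a<r = subst (a <_) p (≤-trans (m<m+n a (s≤s z≤n)) (m≤m+n (a + suc b) 1))
    0<r-a : 0 < ∣ r - a ∣
    0<r-a = subst (0 <_) (sym (m≤n⇒∣n-m∣≡n∸m (<⇒≤ a<r))) (m<n⇒0<n∸m a<r)
    2<Δ : 2 < ∣ r - a ∣ + suc b + 1
    2<Δ = +-monoˡ-≤ 1 (+-mono-≤ 0<r-a (s≤s z≤n))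

  module _ {o : Orientation r} where

    arc⇒k≤1+k : ∀ {u v} → arc o u v ≡ true → k v ≤ suc (k u)
    arc⇒k≤1+k {u} {v} u→v = Adj⇒k≤1+k u v (arc⇒adj o u v u→v)

    arc⇒k≤1+k′ : ∀ {u v} → arc o u v ≡ true → k u ≤ suc (k v)
    arc⇒k≤1+k′ {u} {v} u→v = Adj⇒k≤1+k v u (Adj-sym u v (arc⇒adj o u v u→v))

    Walk-k-rise : ∀ {u v n} → Walk o u v n → k v ≤ n + k u
    Walk-k-rise [] = ≤-refl
    Walk-k-rise {u} {n = suc n} (u→w ∷ w⇝v) =
      ≤-trans (Walk-k-rise w⇝v)
        (≤-trans (+-monoʳ-≤ n (arc⇒k≤1+k u→w)) (≤-reflexive (+-suc n (k u))))

    Walk-k-fall : ∀ {u v n} → Walk o u v n → k u ≤ n + k v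
    Walk-k-fall [] = ≤-refl
    Walk-k-fall (u→w ∷ w⇝v) =
      ≤-trans (arc⇒k≤1+k′ u→w) (s≤s (Walk-k-fall w⇝v))

    Walk-unsnoc : ∀ {u v n} → Walk o u v (suc n) → ∃[ w ] (Walk o u w n × arc o w v ≡ true)
    Walk-unsnoc (u→v ∷ []) = _ , [] , u→v
    Walk-unsnoc (u→w ∷ w⇝v@(_ ∷ _)) with Walk-unsnoc w⇝v
    ... | x , w⇝x , x→v = x , u→w ∷ w⇝x , x→v

    tight-first-step : ∀ {u w v m} → arc o u w ≡ true → Walk o w v m →
                       k u + suc m ≤ k v → k w ≡ suc (k u)
    tight-first-step {u} {w} {m = m} u→w w⇝v tight =
      squeeze (k u) m (k w) (≤-trans tight (Walk-k-rise w⇝v)) (arc⇒k≤1+k u→w)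

    tight-last-step : ∀ {u w v m} → Walk o u w m → arc o w v ≡ true →
                      k v + suc m ≤ k u → k w ≡ suc (k v)
    tight-last-step {w = w} {v} {m} u⇝w w→v tight =
      squeeze (k v) m (k w) (≤-trans tight (Walk-k-fall u⇝w)) (arc⇒k≤1+k′ w→v)

-- The two corners differ, so empty walks between them are ruled out by unification.
lemma1 : ∀ (r : ℕ) → 2 ≤ r → ¬ ODLe r r
lemma1 (suc (suc q)) (s≤s (s≤s z≤n)) (o , _ , diam) with diam cornerᵢ cornerₖ | diam cornerₖ cornerᵢ
... | suc m , m<r , _∷_ {w = w} A→w w⇝Z | suc m′ , m′<r , Z⇝A with Walk-unsnoc Z⇝A
... | w′ , Z⇝w′ , w′→A = antisym o cornerᵢ w A→w (subst (λ x → arc o x cornerᵢ ≡ true) w′≡w w′→A)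
  where
  kw≡1 : k w ≡ 1
  kw≡1 = tight-first-step A→w w⇝Z m<r
  kw′≡1 : k w′ ≡ 1
  kw′≡1 = tight-last-step Z⇝w′ w′→A m′<r
  w′≡w : w′ ≡ w
  w′≡w = Vertex-≡
    (trans (cornerᵢ-neighbour-j≡0 w′ (Adj-sym w′ cornerᵢ (arc⇒adj o w′ cornerᵢ w′→A)) kw′≡1)
           (sym (cornerᵢ-neighbour-j≡0 w (arc⇒adj o cornerᵢ w A→w) kw≡1)))
    (trans kw′≡1 (sym kw≡1))
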